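{- For every integer $n\ge 1$, $\mathrm{a}_{011,100}(n)=\binom{n}{2}+1$.
   Context: An ascent of an integer word $x_1\cdots x_n$ is an index $j$ with $x_j<x_{j+1}$; $\mathrm{asc}(x_1\cdots x_n)$ denotes the number of ascents. An ascent sequence of length $n$ is a sequence $x_1\cdots x_n$ of nonnegative integers with $x_1=0$ and $x_i\le \mathrm{asc}(x_1\cdots x_{i-1})+1$ for all $1<i\le n$. A pattern is a word $p=p_1\cdots p_k$ of nonnegative integers whose set of values is $\{0,1,\dots,m\}$ for some $m$. A word $x_1\cdots x_n$ contains $p$ if there are indices $i_1<\cdots<i_k$ such that $x_{i_1}\cdots x_{i_k}$ is order-isomorphic to $p$ (i.e. for all $s,t$, $x_{i_s}<x_{i_t}$ iff $p_s<p_t$ and $x_{i_s}=x_{i_t}$ iff $p_s=p_t$); otherwise it avoids $p$. For a list $B$ of patterns, $\mathcal{A}_B(n)$ is the set of ascent sequences of length $n$ avoiding every pattern in $B$, and $\mathrm{a}_B(n)=|\mathcal{A}_B(n)|$. -}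

module Defs where

open import Data.Nat using (ℕ; zero; suc; _+_; _<_; _≤_; _<?_)
open import Relation.Nullary using (yes; no)
open import Data.List using (_++_)
import Data.Fin
open import Data.List using (List; []; _∷_; length; lookup)
open import Data.Fin using (Fin)
open import Data.Product using (_×_; ∃-syntax)
open import Data.List.Relation.Binary.Sublist.Propositional using (_⊆_)
open import Relation.Binary.PropositionalEquality using (_≡_)
open import Relation.Nullary using (¬_)
open import Function.Bundles using (_⇔_)

ascStep : ℕ → ℕ → ℕ
ascStep x y with x <? y
... | yes _ = 1
... | no _  = 0

ascFrom : ℕ → List ℕ → ℕ
ascFrom x [] = 0
ascFrom x (y ∷ ys) = ascStep x y + ascFrom y ys

asc : List ℕ → ℕ
asc [] = 0
asc (x ∷ xs) = ascFrom x xs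

-- Ascent sequences, built by appending: x₁ = 0, and a new last entry xᵢ
-- (i > 1) must satisfy xᵢ ≤ asc(x₁⋯x_{i-1}) + 1. The empty word is the
-- (length-0) ascent sequence; it is irrelevant since n ≥ 1.
data AscentSeq : List ℕ → Set where
  nil  : AscentSeq []
  one  : AscentSeq (0 ∷ [])
  snoc : ∀ {xs x} → AscentSeq xs → ¬ (xs ≡ []) → x ≤ asc xs + 1 →
         AscentSeq (xs ++ (x ∷ []))

OrderIso : List ℕ → List ℕ → Set
OrderIso w p = Data.Product.Σ (length w ≡ length p) λ eq →
  ∀ (s t : Fin (length w)) →
    ((lookup w s < lookup w t) ⇔ (lookup p (Data.Fin.cast eq s) < lookup p (Data.Fin.cast eq t)))
    × ((lookup w s ≡ lookup w t) ⇔ (lookup p (Data.Fin.cast eq s) ≡ lookup p (Data.Fin.cast eq t)))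

Contains : List ℕ → List ℕ → Set
Contains x p = ∃[ s ] (s ⊆ x × OrderIso s p)

Avoids : List ℕ → List ℕ → Set
Avoids x p = ¬ Contains x p

p011 p100 : List ℕ
p011 = 0 ∷ 1 ∷ 1 ∷ []
p100 = 1 ∷ 0 ∷ 0 ∷ []

InA : ℕ → List ℕ → Set
InA n x = AscentSeq x × length x ≡ n × Avoids x p011 × Avoids x p100

-- A word contains 011 or 100 exactly when it has a subsequence a b b with a ≠ b.
-- Along an ascent sequence avoiding both, the number of ascents m stays equal to the
-- maximum, and every value 1, …, m occurs after a 0. So the next letter is 0 or m + 1
-- (a larger one breaks the ascent condition, a positive smaller one b completes 0 b b),
-- and a 0 may follow a positive letter j only once (else j 0 0). The avoiding ascent
-- sequences are therefore 0ⁱ 1 2 ⋯ m and 0ⁱ 1 ⋯ j 0 (j+1) ⋯ m with i, j ≥ 1: the words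
-- accepted by an automaton recording the maximum m and whether the drop to 0 happened.
-- Listing the accepted words of length n along the transitions gives each exactly once:
-- n of the first shape and C(n−1, 2) of the second.

module Submission where

open import Defs
open import Data.Bool using (Bool; true; false; T; if_then_else_)
open import Data.Nat using (ℕ; zero; suc; _≥_; _+_; _≤_; _<_; z≤n; s≤s; _≟_; _<?_)
open import Data.Nat.Properties
  using (+-suc; +-identityʳ; ≤-refl; ≤-reflexive; +-comm; m≤n⇒m≤1+n; m≤n⇒m<n∨m≡n;
         ≤∧≢⇒<; ≤-pred; <-irrefl; <-asym; <⇒≢; <-cmp; 0≢1+n)
open import Data.Nat.Combinatorics using (_C_; nCk+nC[k+1]≡[n+1]C[k+1]; nC1≡n)
open import Data.Nat.Tactic.RingSolver using (solve-∀)
open import Data.List using (List; []; _∷_; [_]; _++_; _∷ʳ_; length; map)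
open import Data.Nat.ListAction using (sum)
open import Data.List.Properties using (length-++; length-map; ∷ʳ-injective; ∷-injectiveʳ)
open import Data.List.Reverse using (Reverse; []; _∶_∶ʳ_; reverseView)
open import Data.List.Membership.Propositional using (_∈_; _∉_)
open import Data.List.Membership.Propositional.Properties
  using (∈-++⁺ˡ; ∈-++⁺ʳ; ∈-++⁻; ∈-map⁺; ∈-map⁻)
open import Data.List.Relation.Unary.Any using (here; there)
open import Data.List.Relation.Unary.All as All using (All; []; _∷_)
open import Data.List.Relation.Unary.All.Properties
  using (All¬⇒¬Any) renaming (++⁺ to All-++⁺)
open import Data.List.Relation.Unary.AllPairs using ([]; _∷_)
open import Data.List.Relation.Unary.Unique.Propositional using (Unique)
import Data.List.Relation.Unary.Unique.Propositional.Properties as Unique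
open import Data.List.Relation.Binary.Sublist.Propositional
  using (_⊆_; []; _∷_; lookup; from∈; ⊆-refl)
import Data.List.Relation.Binary.Sublist.Propositional as Sublist
open import Data.List.Relation.Binary.Sublist.Propositional.Properties
  using (∷ˡ⁻; ++⁺; ++⁺ʳ)
open import Data.Fin using (Fin; zero; suc)
open import Data.Product using (_×_; ∃-syntax; _,_; proj₁; proj₂)
open import Data.Sum using (_⊎_; inj₁; inj₂)
open import Data.Empty using (⊥-elim)
open import Data.Unit using (⊤; tt)
open import Function using (_∘_)
open import Function.Bundles using (_⇔_; mk⇔; Equivalence)
open import Function.Construct.Composition using (_⇔-∘_)
open import Relation.Binary using (tri<; tri≈; tri>)
open import Relation.Binary.PropositionalEquality
  using (_≡_; _≢_; refl; sym; trans; cong; cong₂; subst; module ≡-Reasoning)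
open import Relation.Nullary using (¬_; yes; no)

⊆-∷ʳ⁻ : ∀ {A : Set} {s : List A} xs {y} →
        s ⊆ xs ∷ʳ y → s ⊆ xs ⊎ ∃[ s′ ] (s ≡ s′ ∷ʳ y × s′ ⊆ xs)
⊆-∷ʳ⁻ []       (_ Sublist.∷ʳ [])  = inj₁ []
⊆-∷ʳ⁻ []       (refl ∷ [])        = inj₂ ([] , refl , [])
⊆-∷ʳ⁻ (x ∷ xs) (_ Sublist.∷ʳ p) with ⊆-∷ʳ⁻ xs p
... | inj₁ q             = inj₁ (x Sublist.∷ʳ q)
... | inj₂ (s′ , e , q)  = inj₂ (s′ , e , x Sublist.∷ʳ q)
⊆-∷ʳ⁻ (x ∷ xs) (refl ∷ p) with ⊆-∷ʳ⁻ xs p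
... | inj₁ q             = inj₁ (refl ∷ q)
... | inj₂ (s′ , e , q)  = inj₂ (x ∷ s′ , cong (x ∷_) e , refl ∷ q)

∷ʳ-⊆-∷ʳ⁻ : ∀ {A : Set} ws {xs : List A} {z y} →
           ws ∷ʳ z ⊆ xs ∷ʳ y → ws ∷ʳ z ⊆ xs ⊎ (z ≡ y × ws ⊆ xs)
∷ʳ-⊆-∷ʳ⁻ ws {xs} p with ⊆-∷ʳ⁻ xs p
... | inj₁ q = inj₁ q
... | inj₂ (s′ , e , q) with ∷ʳ-injective ws s′ e
...   | refl , z≡y = inj₂ (z≡y , q)

ascStep-< : ∀ {x y} → x < y → ascStep x y ≡ 1
ascStep-< {x} {y} x<y with x <? y
... | yes _   = refl
... | no x≮y = ⊥-elim (x≮y x<y)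

ascStep-0 : ∀ x → ascStep x 0 ≡ 0
ascStep-0 x with x <? 0
... | no _ = refl

ascFrom-∷ʳ-above : ∀ {y} x ys → All (_< y) (x ∷ ys) →
                   ascFrom x (ys ∷ʳ y) ≡ suc (ascFrom x ys)
ascFrom-∷ʳ-above x []       (x<y ∷ _)  = cong (_+ 0) (ascStep-< x<y)
ascFrom-∷ʳ-above x (z ∷ zs) (_ ∷ all<) =
  trans (cong (ascStep x z +_) (ascFrom-∷ʳ-above z zs all<)) (+-suc (ascStep x z) _)

ascFrom-∷ʳ0 : ∀ x ys → ascFrom x (ys ∷ʳ 0) ≡ ascFrom x ys
ascFrom-∷ʳ0 x []       = cong (_+ 0) (ascStep-0 x)
ascFrom-∷ʳ0 x (z ∷ zs) = cong (ascStep x z +_) (ascFrom-∷ʳ0 z zs)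

asc-∷ʳ-above : ∀ {x xs y} → x ∈ xs → All (_< y) xs → asc (xs ∷ʳ y) ≡ suc (asc xs)
asc-∷ʳ-above {xs = z ∷ zs} _ = ascFrom-∷ʳ-above z zs

asc-∷ʳ0 : ∀ {x xs} → x ∈ xs → asc (xs ∷ʳ 0) ≡ asc xs
asc-∷ʳ0 {xs = z ∷ zs} _ = ascFrom-∷ʳ0 z zs

prefixed : {A : Set} → (A → List (List A)) → List A → List (List A)
prefixed f []       = []
prefixed f (y ∷ ys) = map (y ∷_) (f y) ++ prefixed f ys

module _ {A : Set} (f : A → List (List A)) where

  ∈-prefixed⁺ : ∀ {y w ys} → y ∈ ys → w ∈ f y → (y ∷ w) ∈ prefixed f ys
  ∈-prefixed⁺ (here refl)  w∈ = ∈-++⁺ˡ (∈-map⁺ (_ ∷_) w∈)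
  ∈-prefixed⁺ {ys = z ∷ _} (there y∈) w∈ =
    ∈-++⁺ʳ (map (z ∷_) (f z)) (∈-prefixed⁺ y∈ w∈)

  ∈-prefixed⁻ : ∀ {y w} ys → (y ∷ w) ∈ prefixed f ys → y ∈ ys × w ∈ f y
  ∈-prefixed⁻ (z ∷ zs) p with ∈-++⁻ (map (z ∷_) (f z)) p
  ... | inj₁ q with ∈-map⁻ (z ∷_) q
  ...   | _ , w∈ , refl = here refl , w∈
  ∈-prefixed⁻ (z ∷ zs) p | inj₂ q = let y∈ , w∈ = ∈-prefixed⁻ zs q in there y∈ , w∈

  []∉prefixed : ∀ ys → [] ∉ prefixed f ys
  []∉prefixed (z ∷ zs) p with ∈-++⁻ (map (z ∷_) (f z)) p
  ... | inj₁ q with ∈-map⁻ (z ∷_) q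
  ...   | _ , _ , ()
  []∉prefixed (z ∷ zs) p | inj₂ q = []∉prefixed zs q

  prefixed-unique : ∀ {ys} → Unique ys → (∀ y → Unique (f y)) → Unique (prefixed f ys)
  prefixed-unique []                   _  = []
  prefixed-unique {y ∷ ys} (y∉ys ∷ uys) uf =
    Unique.++⁺ (Unique.map⁺ ∷-injectiveʳ (uf y)) (prefixed-unique uys uf) disjoint
    where
    disjoint : ∀ {v} → ¬ (v ∈ map (y ∷_) (f y) × v ∈ prefixed f ys)
    disjoint (p , q) with ∈-map⁻ (y ∷_) p
    ... | _ , _ , refl = All¬⇒¬Any y∉ys (proj₁ (∈-prefixed⁻ ys q))

  length-prefixed : ∀ ys → length (prefixed f ys) ≡ sum (map (length ∘ f) ys)
  length-prefixed []       = refl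
  length-prefixed (y ∷ ys) =
    trans (length-++ (map (y ∷_) (f y)))
          (cong₂ _+_ (length-map (y ∷_) (f y)) (length-prefixed ys))

-- The patterns 011 and 100

AvoidsXYY : List ℕ → Set
AvoidsXYY w = ∀ {a b} → (a ∷ b ∷ b ∷ []) ⊆ w → a ≡ b

SameComparison : ℕ → ℕ → ℕ → ℕ → Set
SameComparison a b c d = (a < b ⇔ c < d) × (b < a ⇔ d < c) × (a ≡ b ⇔ c ≡ d)

⇔-true : ∀ {P Q : Set} → P → Q → P ⇔ Q
⇔-true p q = mk⇔ (λ _ → q) (λ _ → p)

⇔-false : ∀ {P Q : Set} → ¬ P → ¬ Q → P ⇔ Q
⇔-false ¬p ¬q = mk⇔ (⊥-elim ∘ ¬p) (⊥-elim ∘ ¬q)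

<-sameComparison : ∀ {a b c d} → a < b → c < d → SameComparison a b c d
<-sameComparison a<b c<d =
  ⇔-true a<b c<d , ⇔-false (<-asym a<b) (<-asym c<d) , ⇔-false (<⇒≢ a<b) (<⇒≢ c<d)

>-sameComparison : ∀ {a b c d} → b < a → d < c → SameComparison a b c d
>-sameComparison b<a d<c =
  ⇔-false (<-asym b<a) (<-asym d<c) , ⇔-true b<a d<c ,
  ⇔-false (<⇒≢ b<a ∘ sym) (<⇒≢ d<c ∘ sym)

xyy-orderIso : ∀ {a b c d} → SameComparison a b c d →
               OrderIso (a ∷ b ∷ b ∷ []) (c ∷ d ∷ d ∷ [])
xyy-orderIso {a} {b} {c} {d} (lt , gt , eq) = refl , compare
  where
  diagonal : ∀ {u v} → (u < u ⇔ v < v) × (u ≡ u ⇔ v ≡ v)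
  diagonal = ⇔-false (<-irrefl refl) (<-irrefl refl) , ⇔-true refl refl

  eq′ : b ≡ a ⇔ d ≡ c
  eq′ = mk⇔ (sym ∘ Equivalence.to eq ∘ sym) (sym ∘ Equivalence.from eq ∘ sym)

  compare : (s t : Fin 3) → _
  compare zero             zero             = diagonal
  compare zero             (suc zero)       = lt , eq
  compare zero             (suc (suc zero)) = lt , eq
  compare (suc zero)       zero             = gt , eq′
  compare (suc (suc zero)) zero             = gt , eq′
  compare (suc zero)       (suc zero)       = diagonal
  compare (suc zero)       (suc (suc zero)) = diagonal
  compare (suc (suc zero)) (suc zero)       = diagonal
  compare (suc (suc zero)) (suc (suc zero)) = diagonal

orderIso-xyy : ∀ {w c d} → c ≢ d → OrderIso w (c ∷ d ∷ d ∷ []) →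
               ∃[ a ] ∃[ b ] (w ≡ a ∷ b ∷ b ∷ [] × a ≢ b)
orderIso-xyy {a ∷ b ∷ b′ ∷ []} c≢d (refl , iso)
  with Equivalence.from (proj₂ (iso (suc zero) (suc (suc zero)))) refl
... | refl = a , b , refl , c≢d ∘ Equivalence.to (proj₂ (iso zero (suc zero)))

avoids⇔avoidsXYY : ∀ w → (Avoids w p011 × Avoids w p100) ⇔ AvoidsXYY w
avoids⇔avoidsXYY w = mk⇔ to from
  where
  to : Avoids w p011 × Avoids w p100 → AvoidsXYY w
  to (¬011 , ¬100) {a} {b} sub with <-cmp a b
  ... | tri< a<b _ _ = ⊥-elim (¬011 (_ , sub , xyy-orderIso (<-sameComparison a<b (s≤s z≤n))))
  ... | tri≈ _ a≡b _ = a≡b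
  ... | tri> _ _ b<a = ⊥-elim (¬100 (_ , sub , xyy-orderIso (>-sameComparison b<a (s≤s z≤n))))

  noXYY : ∀ {c d} → c ≢ d → AvoidsXYY w → Avoids w (c ∷ d ∷ d ∷ [])
  noXYY c≢d avoids (v , sub , iso) with orderIso-xyy {v} c≢d iso
  ... | _ , _ , refl , a≢b = a≢b (avoids sub)

  from : AvoidsXYY w → Avoids w p011 × Avoids w p100
  from avoids = noXYY (λ ()) avoids , noXYY (λ ()) avoids

-- The automaton

data State : Set where
  start      : State
  beforeDrop : ℕ → State  -- after reading 0ⁱ 1 2 ⋯ m
  afterDrop  : ℕ → State  -- after reading 0ⁱ 1 ⋯ j 0 (j+1) ⋯ m, with j ≥ 1
  dead       : State

-- the positive letter suc y is allowed only if it is the new maximum suc m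
expect : ℕ → ℕ → State → State
expect y m t with y ≟ m
... | yes _ = t
... | no _  = dead

dropTo0 : ℕ → State
dropTo0 zero    = beforeDrop zero
dropTo0 (suc m) = afterDrop (suc m)

step : State → ℕ → State
step start          zero    = beforeDrop zero
step start          (suc _) = dead
step (beforeDrop m) zero    = dropTo0 m
step (beforeDrop m) (suc y) = expect y m (beforeDrop (suc m))
step (afterDrop m)  zero    = dead
step (afterDrop m)  (suc y) = expect y m (afterDrop (suc m))
step dead           _       = dead

run : State → List ℕ → State
run s []       = s
run s (y ∷ ys) = run (step s y) ys

accepting : State → Bool
accepting (beforeDrop _) = true
accepting (afterDrop _)  = true
accepting _              = false

Accepting : State → Set
Accepting = T ∘ accepting

run-∷ʳ : ∀ s xs y → run s (xs ∷ʳ y) ≡ step (run s xs) y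
run-∷ʳ s []       y = refl
run-∷ʳ s (x ∷ xs) y = run-∷ʳ (step s x) xs y

run-dead : ∀ ys → run dead ys ≡ dead
run-dead []       = refl
run-dead (_ ∷ ys) = run-dead ys

accepting-run⇒≢dead : ∀ {s} ys → Accepting (run s ys) → s ≢ dead
accepting-run⇒≢dead ys live refl = subst Accepting (run-dead ys) live

expect-self : ∀ m t → expect m m t ≡ t
expect-self m t with m ≟ m
... | yes _  = refl
... | no m≢m = ⊥-elim (m≢m refl)

expect-≢dead : ∀ y m t → expect y m t ≢ dead → y ≡ m
expect-≢dead y m t ≢dead with y ≟ m
... | yes y≡m = y≡m
... | no _    = ⊥-elim (≢dead refl)

accepting⇒≢dead : ∀ {s} → Accepting s → s ≢ dead
accepting⇒≢dead live refl = live

accepting-expect⁻ : ∀ y m t → Accepting (expect y m t) → y ≡ m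
accepting-expect⁻ y m t = expect-≢dead y m t ∘ accepting⇒≢dead

next : State → List ℕ
next start          = [ 0 ]
next (beforeDrop m) = 0 ∷ suc m ∷ []
next (afterDrop m)  = [ suc m ]
next dead           = []

next-unique : ∀ s → Unique (next s)
next-unique start          = [] ∷ []
next-unique (beforeDrop m) = ((λ ()) ∷ []) ∷ [] ∷ []
next-unique (afterDrop m)  = [] ∷ []
next-unique dead           = []

∈-next : ∀ s y → step s y ≢ dead → y ∈ next s
∈-next start          zero    _      = here refl
∈-next start          (suc y) ≢dead  = ⊥-elim (≢dead refl)
∈-next (beforeDrop m) zero    _      = here refl
∈-next (beforeDrop m) (suc y) ≢dead  = there (here (cong suc (expect-≢dead y m _ ≢dead)))
∈-next (afterDrop m)  zero    ≢dead  = ⊥-elim (≢dead refl)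
∈-next (afterDrop m)  (suc y) ≢dead  = here (cong suc (expect-≢dead y m _ ≢dead))
∈-next dead           y       ≢dead  = ⊥-elim (≢dead refl)

words : State → ℕ → List (List ℕ)
words s zero    = if accepting s then [ [] ] else []
words s (suc k) = prefixed (λ y → words (step s y) k) (next s)

words-sound : ∀ s k {x} → x ∈ words s k → Accepting (run s x) × length x ≡ k
words-sound (beforeDrop m) zero (here refl) = tt , refl
words-sound (afterDrop m)  zero (here refl) = tt , refl
words-sound s (suc k) {[]}    p = ⊥-elim ([]∉prefixed _ (next s) p)
words-sound s (suc k) {y ∷ x} p =
  let live , len = words-sound (step s y) k (proj₂ (∈-prefixed⁻ _ (next s) p))
  in live , cong suc len

words-complete : ∀ s x → Accepting (run s x) → x ∈ words s (length x)
words-complete (beforeDrop m) [] _ = here refl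
words-complete (afterDrop m)  [] _ = here refl
words-complete s (y ∷ x) live =
  ∈-prefixed⁺ _ (∈-next s y (accepting-run⇒≢dead x live)) (words-complete (step s y) x live)

words-unique : ∀ s k → Unique (words s k)
words-unique start          zero    = []
words-unique (beforeDrop m) zero    = [] ∷ []
words-unique (afterDrop m)  zero    = [] ∷ []
words-unique dead           zero    = []
words-unique s              (suc k) =
  prefixed-unique _ (next-unique s) (λ y → words-unique (step s y) k)

length-words-suc : ∀ s k →
  length (words s (suc k)) ≡ sum (map (λ y → length (words (step s y) k)) (next s))
length-words-suc s k = length-prefixed (λ y → words (step s y) k) (next s)

length-words-afterDrop-suc : ∀ m k →
  length (words (afterDrop m) (suc k)) ≡ length (words (afterDrop (suc m)) k)
length-words-afterDrop-suc m k = begin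
  length (words (afterDrop m) (suc k))
    ≡⟨ length-words-suc (afterDrop m) k ⟩
  length (words (expect m m (afterDrop (suc m))) k) + 0
    ≡⟨ cong (λ t → length (words t k) + 0) (expect-self m _) ⟩
  length (words (afterDrop (suc m)) k) + 0
    ≡⟨ +-identityʳ _ ⟩
  length (words (afterDrop (suc m)) k)
    ∎
  where open ≡-Reasoning

length-words-beforeDrop-suc : ∀ m k → length (words (beforeDrop m) (suc k)) ≡
  length (words (dropTo0 m) k) + length (words (beforeDrop (suc m)) k)
length-words-beforeDrop-suc m k = begin
  length (words (beforeDrop m) (suc k))
    ≡⟨ length-words-suc (beforeDrop m) k ⟩
  length (words (dropTo0 m) k) + (length (words (expect m m (beforeDrop (suc m))) k) + 0)
    ≡⟨ cong (λ t → length (words (dropTo0 m) k) + (length (words t k) + 0)) (expect-self m _) ⟩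
  length (words (dropTo0 m) k) + (length (words (beforeDrop (suc m)) k) + 0)
    ≡⟨ cong (length (words (dropTo0 m) k) +_) (+-identityʳ _) ⟩
  length (words (dropTo0 m) k) + length (words (beforeDrop (suc m)) k)
    ∎
  where open ≡-Reasoning

length-words-afterDrop : ∀ m k → length (words (afterDrop m) k) ≡ 1
length-words-afterDrop m zero    = refl
length-words-afterDrop m (suc k) =
  trans (length-words-afterDrop-suc m k) (length-words-afterDrop (suc m) k)

length-words-beforeDrop-positive : ∀ m k → length (words (beforeDrop (suc m)) k) ≡ suc k
length-words-beforeDrop-positive m zero    = refl
length-words-beforeDrop-positive m (suc k) =
  trans (length-words-beforeDrop-suc (suc m) k)
        (cong₂ _+_ (length-words-afterDrop (suc m) k) (length-words-beforeDrop-positive (suc m) k))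

length-words-beforeDrop-0 : ∀ k → length (words (beforeDrop 0) k) ≡ suc k C 2 + 1
length-words-beforeDrop-0 zero    = refl
length-words-beforeDrop-0 (suc k) = begin
  length (words (beforeDrop 0) (suc k))
    ≡⟨ length-words-beforeDrop-suc 0 k ⟩
  length (words (beforeDrop 0) k) + length (words (beforeDrop 1) k)
    ≡⟨ cong₂ _+_ (length-words-beforeDrop-0 k) (length-words-beforeDrop-positive 0 k) ⟩
  (suc k C 2 + 1) + suc k
    ≡⟨ rearrange (suc k C 2) (suc k) ⟩
  (suc k + suc k C 2) + 1
    ≡⟨ cong (λ c → (c + suc k C 2) + 1) (sym (nC1≡n (suc k))) ⟩
  (suc k C 1 + suc k C 2) + 1
    ≡⟨ cong (_+ 1) (nCk+nC[k+1]≡[n+1]C[k+1] (suc k) 1) ⟩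
  suc (suc k) C 2 + 1
    ∎
  where
  open ≡-Reasoning
  rearrange : ∀ c n → (c + 1) + n ≡ (n + c) + 1
  rearrange = solve-∀

length-words-start : ∀ k → length (words start (suc k)) ≡ suc k C 2 + 1
length-words-start k =
  trans (length-words-suc start k) (trans (+-identityʳ _) (length-words-beforeDrop-0 k))

∈-words : ∀ s k x → x ∈ words s k ⇔ (Accepting (run s x) × length x ≡ k)
∈-words s k x = mk⇔ (words-sound s k) λ { (live , refl) → words-complete s x live }

-- Invariants of the states

record Climbed (m : ℕ) (xs : List ℕ) : Set where
  field
    ascents : asc xs ≡ m
    bounded : All (_≤ m) xs
    zero∈   : 0 ∈ xs
    reached : ∀ {k} → 0 < k → k ≤ m → (0 ∷ k ∷ []) ⊆ xs

climbed-[0] : Climbed 0 [ 0 ]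
climbed-[0] = record
  { ascents = refl ; bounded = z≤n ∷ [] ; zero∈ = here refl ; reached = λ { (s≤s _) () } }

module _ {m xs} (c : Climbed m xs) where
  open Climbed c

  climbed-∷ʳ0 : Climbed m (xs ∷ʳ 0)
  climbed-∷ʳ0 = record
    { ascents = trans (asc-∷ʳ0 zero∈) ascents
    ; bounded = All-++⁺ bounded (z≤n ∷ [])
    ; zero∈   = ∈-++⁺ˡ zero∈
    ; reached = λ 0<k k≤m → ++⁺ʳ [ 0 ] (reached 0<k k≤m)
    }

  climbed-∷ʳ-suc : Climbed (suc m) (xs ∷ʳ suc m)
  climbed-∷ʳ-suc = record
    { ascents = trans (asc-∷ʳ-above zero∈ (All.map s≤s bounded)) (cong suc ascents)
    ; bounded = All-++⁺ (All.map m≤n⇒m≤1+n bounded) (≤-refl ∷ [])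
    ; zero∈   = ∈-++⁺ˡ zero∈
    ; reached = reached′
    }
    where
    reached′ : ∀ {k} → 0 < k → k ≤ suc m → (0 ∷ k ∷ []) ⊆ xs ∷ʳ suc m
    reached′ 0<k k≤1+m with m≤n⇒m<n∨m≡n k≤1+m
    ... | inj₁ k<1+m = ++⁺ʳ [ suc m ] (reached 0<k (≤-pred k<1+m))
    ... | inj₂ refl  = ++⁺ (from∈ zero∈) ⊆-refl

  climbed-∉ : ∀ {a} → ¬ (a ∷ suc m ∷ []) ⊆ xs
  climbed-∉ sub = <-irrefl refl (All.lookup bounded (lookup (∷ˡ⁻ sub) (here refl)))

  climbed-bound : suc m ≤ asc xs + 1
  climbed-bound = ≤-reflexive (trans (+-comm 1 m) (cong (_+ 1) (sym ascents)))

  climbed-next : ∀ {y} → suc y ≤ asc xs + 1 → AvoidsXYY (xs ∷ʳ suc y) → y ≡ m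
  climbed-next {y} y<asc+1 avoids with y ≟ m
  ... | yes y≡m = y≡m
  ... | no y≢m  = ⊥-elim (0≢1+n (avoids (++⁺ (reached (s≤s z≤n) y<m) ⊆-refl)))
    where
    y≤m : y ≤ m
    y≤m = ≤-pred (subst (suc y ≤_) (trans (cong (_+ 1) ascents) (+-comm m 1)) y<asc+1)

    y<m : suc y ≤ m
    y<m = ≤∧≢⇒< y≤m y≢m

NoDropTo0 : List ℕ → Set
NoDropTo0 xs = ∀ {a} → (a ∷ 0 ∷ []) ⊆ xs → a ≡ 0

DropsTo0 : List ℕ → Set
DropsTo0 xs = ∃[ j ] (0 < j × (j ∷ 0 ∷ []) ⊆ xs)

noDropTo0-∷ʳ0 : ∀ {xs} → Climbed 0 xs → NoDropTo0 xs → NoDropTo0 (xs ∷ʳ 0)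
noDropTo0-∷ʳ0 c noDrop {a} sub with ∷ʳ-⊆-∷ʳ⁻ [ a ] sub
... | inj₁ q       = noDrop q
... | inj₂ (_ , q) with All.lookup (Climbed.bounded c) (lookup q (here refl))
...   | z≤n = refl

noDropTo0-∷ʳ-suc : ∀ {xs m} → NoDropTo0 xs → NoDropTo0 (xs ∷ʳ suc m)
noDropTo0-∷ʳ-suc noDrop {a} sub with ∷ʳ-⊆-∷ʳ⁻ [ a ] sub
... | inj₁ q = noDrop q
... | inj₂ (() , _)

Inv : State → List ℕ → Set
Inv start          xs = xs ≡ []
Inv (beforeDrop m) xs = Climbed m xs × NoDropTo0 xs
Inv (afterDrop m)  xs = Climbed m xs × DropsTo0 xs
Inv dead           _  = ⊤

step-inv : ∀ s xs y → Inv s xs → Inv (step s y) (xs ∷ʳ y)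
step-inv start .[] zero refl =
  climbed-[0] , λ { (_ Sublist.∷ʳ ()) ; (_ ∷ ()) }
step-inv start xs (suc y) _ = tt
step-inv (beforeDrop zero) xs zero (c , noDrop) = climbed-∷ʳ0 c , noDropTo0-∷ʳ0 c noDrop
step-inv (beforeDrop (suc m)) xs zero (c , _) =
  climbed-∷ʳ0 c ,
  suc m , s≤s z≤n , ++⁺ (∷ˡ⁻ (Climbed.reached c (s≤s z≤n) ≤-refl)) ⊆-refl
step-inv (beforeDrop m) xs (suc y) (c , noDrop) with y ≟ m
... | yes refl = climbed-∷ʳ-suc c , noDropTo0-∷ʳ-suc noDrop
... | no _     = tt
step-inv (afterDrop m) xs zero _ = tt
step-inv (afterDrop m) xs (suc y) (c , j , 0<j , q) with y ≟ m
... | yes refl = climbed-∷ʳ-suc c , j , 0<j , ++⁺ʳ [ suc m ] q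
... | no _     = tt
step-inv dead xs y _ = tt

invariant : ∀ xs → Inv (run start xs) xs
invariant xs = go (reverseView xs)
  where
  go : ∀ {xs} → Reverse xs → Inv (run start xs) xs
  go []             = refl
  go (xs ∶ r ∶ʳ y) =
    subst (λ s → Inv s (xs ∷ʳ y)) (sym (run-∷ʳ start xs y)) (step-inv _ xs y (go r))

accepting-expect : ∀ {y m t} → y ≡ m → Accepting t → Accepting (expect y m t)
accepting-expect {t = t} refl live = subst Accepting (sym (expect-self _ t)) live

accepting-step⇒first⊎accepting : ∀ s xs y → Inv s xs → Accepting (step s y) →
                                 (xs ≡ [] × y ≡ 0) ⊎ Accepting s
accepting-step⇒first⊎accepting start          _ zero refl _ = inj₁ (refl , refl)
accepting-step⇒first⊎accepting (beforeDrop m) _ _    _    _ = inj₂ tt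
accepting-step⇒first⊎accepting (afterDrop m)  _ _    _    _ = inj₂ tt

accepting-step⇒bounded : ∀ s xs y → Inv s xs → Accepting (step s y) → Accepting s →
                         y ≤ asc xs + 1
accepting-step⇒bounded (beforeDrop m) xs zero    _       _    _ = z≤n
accepting-step⇒bounded (beforeDrop m) xs (suc y) (c , _) live _
  with accepting-expect⁻ y m _ live
... | refl = climbed-bound c
accepting-step⇒bounded (afterDrop m)  xs (suc y) (c , _) live _
  with accepting-expect⁻ y m _ live
... | refl = climbed-bound c

accepting-step⇒repeat : ∀ s xs y → Inv s xs → Accepting (step s y) →
                        ∀ {a} → (a ∷ y ∷ []) ⊆ xs → a ≡ y
accepting-step⇒repeat start          .[] zero   refl _ ()
accepting-step⇒repeat (beforeDrop m) xs zero    (_ , noDrop) _ sub = noDrop sub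
accepting-step⇒repeat (beforeDrop m) xs (suc y) (c , _)      live sub
  with accepting-expect⁻ y m _ live
... | refl = ⊥-elim (climbed-∉ c sub)
accepting-step⇒repeat (afterDrop m)  xs (suc y) (c , _)      live sub
  with accepting-expect⁻ y m _ live
... | refl = ⊥-elim (climbed-∉ c sub)

accepting-step⇐ : ∀ s xs y → Inv s xs → Accepting s → y ≤ asc xs + 1 →
                  AvoidsXYY (xs ∷ʳ y) → Accepting (step s y)
accepting-step⇐ (beforeDrop zero)    xs zero    _ _ _ _ = tt
accepting-step⇐ (beforeDrop (suc m)) xs zero    _ _ _ _ = tt
accepting-step⇐ (beforeDrop m)       xs (suc y) (c , _) _ bound avoids =
  accepting-expect (climbed-next c bound avoids) tt
accepting-step⇐ (afterDrop m)        xs zero    (_ , j , 0<j , q) _ _ avoids =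
  ⊥-elim (<⇒≢ 0<j (sym (avoids (++⁺ q ⊆-refl))))
accepting-step⇐ (afterDrop m)        xs (suc y) (c , _) _ bound avoids =
  accepting-expect (climbed-next c bound avoids) tt

accepting⇒nonempty : ∀ {xs} → Accepting (run start xs) → xs ≢ []
accepting⇒nonempty live refl = live

accepting⇒ascentSeq : ∀ xs → Accepting (run start xs) → AscentSeq xs
accepting⇒ascentSeq xs = go (reverseView xs)
  where
  go : ∀ {xs} → Reverse xs → Accepting (run start xs) → AscentSeq xs
  go (xs ∶ r ∶ʳ y) live rewrite run-∷ʳ start xs y
    with accepting-step⇒first⊎accepting _ xs y (invariant xs) live
  ... | inj₁ (refl , refl) = one
  ... | inj₂ live-xs       = snoc (go r live-xs) (accepting⇒nonempty live-xs)
                                   (accepting-step⇒bounded _ xs y (invariant xs) live live-xs)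

accepting⇒avoidsXYY : ∀ xs → Accepting (run start xs) → AvoidsXYY xs
accepting⇒avoidsXYY xs = go (reverseView xs)
  where
  go : ∀ {xs} → Reverse xs → Accepting (run start xs) → AvoidsXYY xs
  go (xs ∶ r ∶ʳ y) live {a} {b} sub rewrite run-∷ʳ start xs y
    with ∷ʳ-⊆-∷ʳ⁻ (a ∷ b ∷ []) sub
  ... | inj₂ (refl , q) = accepting-step⇒repeat _ xs y (invariant xs) live q
  ... | inj₁ q with accepting-step⇒first⊎accepting _ xs y (invariant xs) live
  ...   | inj₂ live-xs   = go r live-xs q
  ...   | inj₁ (refl , _) with q
  ...     | ()

ascentSeq⇒accepting : ∀ {xs} → AscentSeq xs → xs ≢ [] → AvoidsXYY xs →
                      Accepting (run start xs)
ascentSeq⇒accepting nil      nonempty _ = ⊥-elim (nonempty refl)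
ascentSeq⇒accepting one      _        _ = tt
ascentSeq⇒accepting (snoc {xs} {y} seq nonempty bounded) _ avoids =
  subst Accepting (sym (run-∷ʳ start xs y))
    (accepting-step⇐ _ xs y (invariant xs) live-xs bounded avoids)
  where
  live-xs : Accepting (run start xs)
  live-xs = ascentSeq⇒accepting seq nonempty (λ sub → avoids (++⁺ʳ [ y ] sub))

accepting⇔InA : ∀ n x → (Accepting (run start x) × length x ≡ suc n) ⇔ InA (suc n) x
accepting⇔InA n x = mk⇔ to from
  where
  to : Accepting (run start x) × length x ≡ suc n → InA (suc n) x
  to (live , len) =
    let ¬011 , ¬100 = Equivalence.from (avoids⇔avoidsXYY x) (accepting⇒avoidsXYY x live)
    in accepting⇒ascentSeq x live , len , ¬011 , ¬100

  from : InA (suc n) x → Accepting (run start x) × length x ≡ suc n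
  from (seq , len , ¬011 , ¬100) =
    ascentSeq⇒accepting seq (λ x≡[] → 0≢1+n (trans (cong length (sym x≡[])) len))
      (Equivalence.to (avoids⇔avoidsXYY x) (¬011 , ¬100)) ,
    len

proposition2p11 : ∀ (n : ℕ) → n ≥ 1 →
    ∃[ L ] (Unique L × (∀ (x : List ℕ) → (x ∈ L ⇔ InA n x)) × length L ≡ (n C 2) + 1)
proposition2p11 (suc n) _ =
  words start (suc n) ,
  words-unique start (suc n) ,
  (λ x → accepting⇔InA n x ⇔-∘ ∈-words start (suc n) x) ,
  length-words-start n
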